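{- Let $k$ be a multiple of $4$ with $k\ge 4$. There are infinitely many $n$ (with $k\le n$ and $k\le 2^{n/4}$) such that every deterministic OBDD and every nondeterministic OBDD on $n$ variables computing $\mathtt{EQS^k_{n}}$ has width at least $2^{k/4}$.
   Context: For $\nu\in\{0,1\}^n$, among the first $k$ bits, call the odd positions marker bits and the even positions value bits. For $1\le i\le k/2$, the value bit $\nu_{2i}$ is appended (in order of increasing $i$) to the string $\alpha(\nu)$ if $\nu_{2i-1}=0$ and to $\beta(\nu)$ if $\nu_{2i-1}=1$. $\mathtt{EQS^k_{n}}(\nu)=1$ if $\alpha(\nu)=\beta(\nu)$ and $0$ otherwise. A deterministic OBDD on $x_1,\dots,x_n$ with order $\pi$ (a permutation of $\{1,\dots,n\}$) is a leveled directed acyclic graph with levels $0,\dots,n$, a single source at level $0$, every node at level $j-1$ having exactly one outgoing edge labelled $0$ and one labelled $1$ to nodes at level $j$, and nodes at level $n$ marked accepting or rejecting; on input $\nu$ one follows from the source at step $j$ the edge labelled $\nu_{\pi(j)}$ and outputs $1$ iff an accepting node is reached. A nondeterministic OBDD allows any number of outgoing edges with each label and outputs $1$ iff some consistent path reaches an accepting node. Width is the maximum number of nodes in a level. -}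

module Defs where

open import Data.Bool using (Bool; true; false; if_then_else_)
import Data.Bool as B
open import Data.Nat using (ℕ; zero; suc; _≤_; _<_; _⊔_)
open import Data.Nat.Properties using (<⇒≤; ≤-refl)
open import Data.Fin using (Fin; fromℕ<)
open import Data.Fin.Permutation using (Permutation′; _⟨$⟩ʳ_)
open import Data.List using (List; []; _∷_; take; tabulate; map; foldr; upTo)
open import Data.List.Properties using (≡-dec)
open import Data.Product using (_×_; _,_; Σ)
open import Relation.Binary.PropositionalEquality using (_≡_)
open import Relation.Nullary.Decidable using (⌊_⌋)

-- Inputs are ν : Fin n → Bool; bit x_{i+1} is ν i (0-based indexing).

splitAB : List Bool → List Bool × List Bool
splitAB (m ∷ v ∷ rest) with splitAB rest
... | (a , b) = if m then (a , v ∷ b) else (v ∷ a , b)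
splitAB _ = ([] , [])

EQS : ℕ → (n : ℕ) → (Fin n → Bool) → Bool
EQS k n ν with splitAB (take k (tabulate ν))
... | (a , b) = ⌊ ≡-dec B._≟_ a b ⌋

-- Levels 0..n; level j has nodes Fin (size j). Step j (0 ≤ j < n) goes from
-- level j to level j+1 and reads variable π(j) (order π as a permutation).

widthOf : (n : ℕ) → (ℕ → ℕ) → ℕ
widthOf n size = foldr _⊔_ 0 (map size (upTo (suc n)))

record DOBDD (n : ℕ) : Set where
  field
    order     : Permutation′ n
    size      : ℕ → ℕ
    level0    : size 0 ≡ 1
    source    : Fin (size 0)
    next      : (j : ℕ) → (lt : j < n) → Fin (size j) → Bool → Fin (size (suc j))
    accepting : Fin (size n) → Bool

  run : (Fin n → Bool) → (j : ℕ) → j ≤ n → Fin (size j)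
  run ν zero    _  = source
  run ν (suc j) lt = next j lt (run ν j (<⇒≤ lt)) (ν (order ⟨$⟩ʳ fromℕ< lt))

  output : (Fin n → Bool) → Bool
  output ν = accepting (run ν n ≤-refl)

  width : ℕ
  width = widthOf n size

DComputes : ∀ {n} → DOBDD n → ((Fin n → Bool) → Bool) → Set
DComputes B f = ∀ ν → DOBDD.output B ν ≡ f ν

record NOBDD (n : ℕ) : Set where
  field
    order     : Permutation′ n
    size      : ℕ → ℕ
    level0    : size 0 ≡ 1
    source    : Fin (size 0)
    edge      : (j : ℕ) → (lt : j < n) → Fin (size j) → Bool → Fin (size (suc j)) → Bool
    accepting : Fin (size n) → Bool

  AcceptingPath : (Fin n → Bool) → Set
  AcceptingPath ν =
    Σ ((j : ℕ) → j ≤ n → Fin (size j)) λ p →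
      (p 0 Data.Nat.z≤n ≡ source) ×
      (∀ j (lt : j < n) →
         edge j lt (p j (<⇒≤ lt)) (ν (order ⟨$⟩ʳ fromℕ< lt)) (p (suc j) lt) ≡ true) ×
      (accepting (p n ≤-refl) ≡ true)

  width : ℕ
  width = widthOf n size

NComputes : ∀ {n} → NOBDD n → ((Fin n → Bool) → Bool) → Set
NComputes B f = ∀ ν → (f ν ≡ true → NOBDD.AcceptingPath B ν) × (NOBDD.AcceptingPath B ν → f ν ≡ true)

-- Let k = 4q and order the variables as the OBDD reads them. Counting how many of the 2q
-- value positions are read in the first j steps gives a function of j that starts at 0,
-- ends at 2q and grows by at most one per step, so some cut j has exactly q of them before
-- it. Mark those q pairs as α-pairs and the other q as β-pairs: every word w ∈ {0,1}^q
-- yields an accepted input with α = β = w. If two different words reached the same node at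
-- level j, gluing the first half of one accepting path to the second half of the other
-- would accept an input with α ≠ β. Hence level j has at least 2^q nodes, and a
-- deterministic OBDD is a special nondeterministic one.
module Submission where

open import Defs
open import Level using (0ℓ)
open import Data.Bool using (Bool; true; false)
import Data.Bool as Bool
open import Data.Fin as Fin using (Fin; toℕ; fromℕ<)
open import Data.Fin.Permutation using (Permutation′; _⟨$⟩ʳ_; _⟨$⟩ˡ_; inverseˡ; inverseʳ)
open import Data.Fin.Properties
  using (2↔Bool; toℕ-fromℕ<; fromℕ<-toℕ; toℕ-injective; toℕ<n; injective⇒≤)
open import Data.List using (List; []; _∷_; length; take; drop; tabulate; foldr)
open import Data.List.Properties using (≡-dec)
open import Data.List.Membership.Propositional using (_∈_)
open import Data.List.Membership.Propositional.Properties using (∈-map⁺; ∈-upTo⁺)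
open import Data.List.Relation.Unary.Any using (here; there)
open import Data.Nat using (ℕ; zero; suc; _+_; _*_; _∸_; _^_; _/_; _⊔_; _≤_; _<_; z≤n; s≤s)
open import Data.Nat.Properties
open import Data.Nat.DivMod using (m*n/n≡m)
open import Data.Nat.Divisibility using (_∣_; divides)
open import Data.Product using (_×_; _,_; proj₁; proj₂; ∃-syntax)
open import Data.Sum as Sum using (inj₁; inj₂)
open import Data.Vec using (Vec; toList)
open import Data.Vec.Properties using (toList-injective; length-toList; cast-is-id)
open import Data.Vec.Recursive using (Fin[m^n]↔Fin[m]^n; lift↔)
open import Data.Vec.Recursive.Properties using (↔Vec)
open import Function using (_∘_; _⇔_; mk⇔; _↣_; Injection; Equivalence)
open import Function.Properties.Inverse using (↔-trans; ↔⇒↣)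
open import Relation.Binary.PropositionalEquality
open import Relation.Nullary using (¬_; Dec; yes; no; contradiction)
open import Relation.Nullary.Decidable using (⌊_⌋)
open import Relation.Unary using (Pred; Decidable; _⊆_; _∪_; ｛_｝; Empty)

private variable
  A : Set
  P Q : Pred ℕ 0ℓ
  j k m n s y : ℕ

⌊⌋≡true⇔ : (a? : Dec A) → ⌊ a? ⌋ ≡ true ⇔ A
⌊⌋≡true⇔ (yes a) = mk⇔ (λ _ → a) (λ _ → refl)
⌊⌋≡true⇔ (no ¬a) = mk⇔ (λ ()) (λ a → contradiction a ¬a)

n<2^n : ∀ n → n < 2 ^ n
n<2^n zero    = s≤s z≤n
n<2^n (suc n) = begin-strict
  suc n         ≡⟨ +-comm 1 n ⟩
  n + 1         <⟨ +-mono-<-≤ (n<2^n n) (m^n>0 2 n) ⟩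
  2 ^ n + 2 ^ n ≡⟨ cong (2 ^ n +_) (sym (+-identityʳ (2 ^ n))) ⟩
  2 ^ suc n     ∎
  where open ≤-Reasoning

∈⇒≤-foldr-⊔ : ∀ {x xs} → x ∈ xs → x ≤ foldr _⊔_ 0 xs
∈⇒≤-foldr-⊔ (here refl)  = m≤m⊔n _ _
∈⇒≤-foldr-⊔ (there x∈xs) = ≤-trans (∈⇒≤-foldr-⊔ x∈xs) (m≤n⊔m _ _)

intermediate-value : ∀ (c : ℕ → ℕ) {q} N → (∀ j → j < N → c (suc j) ≤ suc (c j)) →
                     c 0 ≤ q → q ≤ c N → ∃[ j ] j ≤ N × c j ≡ q
intermediate-value c zero    step c0≤q q≤cN = 0 , z≤n , ≤-antisym c0≤q q≤cN
intermediate-value c {q} (suc N) step c0≤q q≤c[1+N] with q ≤? c N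
... | yes q≤cN =
  let j , j≤N , cj≡q = intermediate-value c N (λ j j<N → step j (m<n⇒m<1+n j<N)) c0≤q q≤cN
  in  j , m≤n⇒m≤1+n j≤N , cj≡q
... | no q≰cN = suc N , ≤-refl , ≤-antisym (≤-trans (step N ≤-refl) (≰⇒> q≰cN)) q≤c[1+N]

bitVector : ∀ q → Fin (2 ^ q) ↣ Vec Bool q
bitVector q = ↔⇒↣ (↔-trans (Fin[m^n]↔Fin[m]^n 2 q) (↔-trans (lift↔ q 2↔Bool) (↔Vec q)))

word : ∀ q → Fin (2 ^ q) → List Bool
word q i = toList (Injection.to (bitVector q) i)

length-word : ∀ q (i : Fin (2 ^ q)) → length (word q i) ≡ q
length-word q i = length-toList (Injection.to (bitVector q) i)

word-injective : ∀ q {i i′ : Fin (2 ^ q)} → word q i ≡ word q i′ → i ≡ i′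
word-injective q {i} {i′} eq = Injection.injective (bitVector q)
  (trans (sym (cast-is-id refl (to i))) (toList-injective refl (to i) (to i′) eq))
  where to = Injection.to (bitVector q)

bitAt : List Bool → ℕ → Bool
bitAt []      _       = false
bitAt (x ∷ _) zero    = x
bitAt (_ ∷ L) (suc y) = bitAt L y

input : List Bool → Fin n → Bool
input L = bitAt L ∘ toℕ

take-tabulate-input : (L : List Bool) → length L ≤ n →
                      take (length L) (tabulate {n = n} (input L)) ≡ L
take-tabulate-input []      _         = refl
take-tabulate-input (x ∷ L) (s≤s L≤n) = cong (x ∷_) (take-tabulate-input L L≤n)

EQS-split : ∀ {ν : Fin n → Bool} {a b} → splitAB (take k (tabulate ν)) ≡ (a , b) →
            EQS k n ν ≡ true ⇔ a ≡ b
EQS-split {n} {k} {ν} {a} {b} split with splitAB (take k (tabulate ν)) | split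
... | _ | refl = ⌊⌋≡true⇔ (≡-dec Bool._≟_ a b)

EQS-input : ∀ (L : List Bool) {a b} → length L ≡ k → k ≤ n → splitAB L ≡ (a , b) →
            EQS k n (input L) ≡ true ⇔ a ≡ b
EQS-input L {a} {b} refl k≤n split = EQS-split {k = length L} {ν = input L} {a} {b}
  (trans (cong splitAB (take-tabulate-input L k≤n)) split)

-- interleave P? m a b consists of m (marker, value) pairs, the value of the i-th pair at
-- position 2i+1: it is an α-pair taking the next bit of a if P (2i+1), and a β-pair taking
-- the next bit of b otherwise.
interleave : Decidable P → ℕ → List Bool → List Bool → List Bool
interleave P? zero    a b = []
interleave P? (suc m) a b with P? 1
... | yes _ = false ∷ bitAt a 0 ∷ interleave (P? ∘ (2 +_)) m (drop 1 a) b
... | no  _ = true  ∷ bitAt b 0 ∷ interleave (P? ∘ (2 +_)) m a (drop 1 b)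

αLength : Decidable P → ℕ → ℕ
αLength P? zero    = 0
αLength P? (suc m) with P? 1
... | yes _ = suc (αLength (P? ∘ (2 +_)) m)
... | no  _ = αLength (P? ∘ (2 +_)) m

βLength : Decidable P → ℕ → ℕ
βLength P? zero    = 0
βLength P? (suc m) with P? 1
... | yes _ = βLength (P? ∘ (2 +_)) m
... | no  _ = suc (βLength (P? ∘ (2 +_)) m)

length-interleave : ∀ (P? : Decidable P) m a b → length (interleave P? m a b) ≡ m * 2
length-interleave P? zero    a b = refl
length-interleave P? (suc m) a b with P? 1
... | yes _ = cong (2 +_) (length-interleave (P? ∘ (2 +_)) m (drop 1 a) b)
... | no  _ = cong (2 +_) (length-interleave (P? ∘ (2 +_)) m a (drop 1 b))

splitAB-interleave : ∀ (P? : Decidable P) m {a b} →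
                     length a ≡ αLength P? m → length b ≡ βLength P? m →
                     splitAB (interleave P? m a b) ≡ (a , b)
splitAB-interleave P? zero {[]} {[]} _ _ = refl
splitAB-interleave P? (suc m) |a| |b| with P? 1
splitAB-interleave P? (suc m) {x ∷ _} |a| |b| | yes _ =
  cong (λ (α , β) → x ∷ α , β) (splitAB-interleave (P? ∘ (2 +_)) m (suc-injective |a|) |b|)
splitAB-interleave P? (suc m) {_} {y ∷ _} |a| |b| | no _ =
  cong (λ (α , β) → α , y ∷ β) (splitAB-interleave (P? ∘ (2 +_)) m |a| (suc-injective |b|))

interleave-ignores-β : ∀ (P? : Decidable P) m {a b b′} → P y →
                       bitAt (interleave P? m a b) y ≡ bitAt (interleave P? m a b′) y
interleave-ignores-β P? zero    _  = refl
interleave-ignores-β {y = y} P? (suc m) Py with P? 1 | y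
... | yes _  | zero         = refl
... | no _   | zero         = refl
... | yes _  | suc zero     = refl
... | no ¬P1 | suc zero     = contradiction Py ¬P1
... | yes _  | suc (suc y′) = interleave-ignores-β (P? ∘ (2 +_)) m Py
... | no _   | suc (suc y′) = interleave-ignores-β (P? ∘ (2 +_)) m Py

interleave-ignores-α : ∀ (P? : Decidable P) m {a a′ b} → ¬ P y →
                       bitAt (interleave P? m a b) y ≡ bitAt (interleave P? m a′ b) y
interleave-ignores-α P? zero    _   = refl
interleave-ignores-α {y = y} P? (suc m) ¬Py with P? 1 | y
... | yes _  | zero         = refl
... | no _   | zero         = refl
... | yes P1 | suc zero     = contradiction P1 ¬Py
... | no _   | suc zero     = refl
... | yes _  | suc (suc y′) = interleave-ignores-α (P? ∘ (2 +_)) m ¬Py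
... | no _   | suc (suc y′) = interleave-ignores-α (P? ∘ (2 +_)) m ¬Py

αLength+βLength : ∀ (P? : Decidable P) m → αLength P? m + βLength P? m ≡ m
αLength+βLength P? zero    = refl
αLength+βLength P? (suc m) with P? 1
... | yes _ = cong suc (αLength+βLength (P? ∘ (2 +_)) m)
... | no  _ = trans (+-suc _ _) (cong suc (αLength+βLength (P? ∘ (2 +_)) m))

αLength-empty : ∀ (P? : Decidable P) → Empty P → ∀ m → αLength P? m ≡ 0
αLength-empty P? ∅ zero    = refl
αLength-empty P? ∅ (suc m) with P? 1
... | yes P1 = contradiction P1 (∅ 1)
... | no  _  = αLength-empty (P? ∘ (2 +_)) (∅ ∘ (2 +_)) m

αLength-full : ∀ (P? : Decidable P) m → (∀ y → y < m * 2 → P y) → αLength P? m ≡ m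
αLength-full P? zero    full = refl
αLength-full P? (suc m) full with P? 1
... | yes _  = cong suc (αLength-full (P? ∘ (2 +_)) m (λ y y<2m → full (2 + y) (s≤s (s≤s y<2m))))
... | no ¬P1 = contradiction (full 1 (s≤s (s≤s z≤n))) ¬P1

αLength-mono : ∀ (P? : Decidable P) (Q? : Decidable Q) → P ⊆ Q →
               ∀ m → αLength P? m ≤ αLength Q? m
αLength-mono P? Q? P⊆Q zero    = z≤n
αLength-mono P? Q? P⊆Q (suc m) with P? 1 | Q? 1
... | yes _  | yes _  = s≤s (αLength-mono (P? ∘ (2 +_)) (Q? ∘ (2 +_)) P⊆Q m)
... | yes P1 | no ¬Q1 = contradiction (P⊆Q P1) ¬Q1
... | no _   | yes _  = m≤n⇒m≤1+n (αLength-mono (P? ∘ (2 +_)) (Q? ∘ (2 +_)) P⊆Q m)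
... | no _   | no _   = αLength-mono (P? ∘ (2 +_)) (Q? ∘ (2 +_)) P⊆Q m

shift-⊆∪｛｝ : ∀ {y₀} → P ⊆ Q ∪ ｛ y₀ ｝ → (P ∘ (2 +_)) ⊆ (Q ∘ (2 +_)) ∪ ｛ y₀ ∸ 2 ｝
shift-⊆∪｛｝ P⊆Q+y₀ Py = Sum.map₂ (cong (_∸ 2)) (P⊆Q+y₀ Py)

αLength-insert : ∀ (P? : Decidable P) (Q? : Decidable Q) {y₀} → P ⊆ Q ∪ ｛ y₀ ｝ →
                 ∀ m → αLength P? m ≤ suc (αLength Q? m)
αLength-insert P? Q? P⊆Q+y₀ zero    = z≤n
αLength-insert {P = P} {Q = Q} P? Q? P⊆Q+y₀ (suc m) with P? 1 | Q? 1
... | yes _  | yes _  = s≤s (αLength-insert _ _ (shift-⊆∪｛｝ P⊆Q+y₀) m)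
... | yes P1 | no ¬Q1 = s≤s (αLength-mono _ _ P⊆Q-beyond-1 m)
  where
  P⊆Q-beyond-1 : (P ∘ (2 +_)) ⊆ (Q ∘ (2 +_))
  P⊆Q-beyond-1 Py with P⊆Q+y₀ Py | P⊆Q+y₀ P1
  ... | inj₁ Qy | _       = Qy
  ... | inj₂ _  | inj₁ Q1 = contradiction Q1 ¬Q1
  ... | inj₂ e  | inj₂ e′ = contradiction (trans (sym e′) e) λ ()
... | no _   | yes _  = m≤n⇒m≤1+n (αLength-insert _ _ (shift-⊆∪｛｝ P⊆Q+y₀) m)
... | no _   | no _   = αLength-insert _ _ (shift-⊆∪｛｝ P⊆Q+y₀) m

readAt : Permutation′ n → s < n → Fin n
readAt π s<n = π ⟨$⟩ʳ fromℕ< s<n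

module _ (π : Permutation′ n) where

  -- The step at which π reads position y; the junk value n for y ≥ n is never below a cut.
  rank : ℕ → ℕ
  rank y with y <? n
  ... | yes y<n = toℕ (π ⟨$⟩ˡ fromℕ< y<n)
  ... | no  _   = n

  rank-read : (s<n : s < n) → rank (toℕ (readAt π s<n)) ≡ s
  rank-read {s} s<n with toℕ (readAt π s<n) <? n
  ... | yes y<n = begin
    toℕ (π ⟨$⟩ˡ fromℕ< y<n)          ≡⟨ cong (toℕ ∘ (π ⟨$⟩ˡ_)) (fromℕ<-toℕ _ y<n) ⟩
    toℕ (π ⟨$⟩ˡ (π ⟨$⟩ʳ fromℕ< s<n)) ≡⟨ cong toℕ (inverseˡ π) ⟩
    toℕ (fromℕ< s<n)                 ≡⟨ toℕ-fromℕ< s<n ⟩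
    s                                ∎
    where open ≡-Reasoning
  ... | no y≮n = contradiction (toℕ<n _) y≮n

  rank<n : y < n → rank y < n
  rank<n {y} y<n with y <? n
  ... | yes _  = toℕ<n _
  ... | no y≮n = contradiction y<n y≮n

  rank≡⇒ : (s<n : s < n) → rank y ≡ s → y ≡ toℕ (readAt π s<n)
  rank≡⇒ {s} {y} s<n rank≡s with y <? n
  ... | yes y<n = begin
    y                                ≡⟨ toℕ-fromℕ< y<n ⟨
    toℕ (fromℕ< y<n)                 ≡⟨ cong toℕ (inverseʳ π) ⟨
    toℕ (π ⟨$⟩ʳ (π ⟨$⟩ˡ fromℕ< y<n)) ≡⟨ cong (toℕ ∘ (π ⟨$⟩ʳ_)) (toℕ-injective π⁻¹y≡s) ⟩
    toℕ (π ⟨$⟩ʳ fromℕ< s<n)          ∎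
    where
    open ≡-Reasoning
    π⁻¹y≡s : toℕ (π ⟨$⟩ˡ fromℕ< y<n) ≡ toℕ (fromℕ< s<n)
    π⁻¹y≡s = trans rank≡s (sym (toℕ-fromℕ< s<n))
  ... | no _ = contradiction (subst (_< n) (sym rank≡s) s<n) (n≮n n)

≤-widthOf : ∀ (size : ℕ → ℕ) → j ≤ n → size j ≤ widthOf n size
≤-widthOf size j≤n = ∈⇒≤-foldr-⊔ (∈-map⁺ size (∈-upTo⁺ (s≤s j≤n)))

toNOBDD : DOBDD n → NOBDD n
toNOBDD D = record
  { order = order ; size = size ; level0 = level0 ; source = source
  ; edge = λ j j<n u b v → ⌊ next j j<n u b Fin.≟ v ⌋ ; accepting = accepting }
  where open DOBDD D

toNOBDD-computes : ∀ (D : DOBDD n) {f} → DComputes D f → NComputes (toNOBDD D) f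
toNOBDD-computes {n} D {f} computes ν = accepted , sound
  where
  open DOBDD D

  bit : ∀ {j} → j < n → Bool
  bit j<n = ν (readAt order j<n)

  accepted : f ν ≡ true → NOBDD.AcceptingPath (toNOBDD D) ν
  accepted fν = run ν , refl , edges , trans (computes ν) fν
    where
    edges : ∀ j (j<n : j < n) → ⌊ run ν (suc j) j<n Fin.≟ run ν (suc j) j<n ⌋ ≡ true
    edges j j<n = Equivalence.from (⌊⌋≡true⇔ (run ν (suc j) j<n Fin.≟ run ν (suc j) j<n)) refl

  sound : NOBDD.AcceptingPath (toNOBDD D) ν → f ν ≡ true
  sound (p , p₀ , edges , acc) =
    trans (sym (computes ν)) (subst (λ u → accepting u ≡ true) (p≡run n ≤-refl) acc)
    where
    p≡run : ∀ j (j≤n : j ≤ n) → p j j≤n ≡ run ν j j≤n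
    p≡run zero    z≤n = p₀
    p≡run (suc j) j<n = begin
      p (suc j) j<n                         ≡⟨ Equivalence.to (⌊⌋≡true⇔ (_ Fin.≟ _)) (edges j j<n) ⟨
      next j j<n (p j j≤n) (bit j<n)        ≡⟨ cong (λ u → next j j<n u (bit j<n)) (p≡run j j≤n) ⟩
      next j j<n (run ν j j≤n) (bit j<n)    ∎
      where
      open ≡-Reasoning
      j≤n : j ≤ n
      j≤n = <⇒≤ j<n

module _ (B : NOBDD n) where
  open NOBDD B

  splice : ∀ {ν₁ ν₂ ν} (j≤n : j ≤ n) (path₁ : AcceptingPath ν₁) (path₂ : AcceptingPath ν₂) →
           proj₁ path₁ j j≤n ≡ proj₁ path₂ j j≤n →
           (∀ s (s<n : s < n) → s < j → ν (readAt order s<n) ≡ ν₁ (readAt order s<n)) →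
           (∀ s (s<n : s < n) → j ≤ s → ν (readAt order s<n) ≡ ν₂ (readAt order s<n)) →
           AcceptingPath ν
  splice {j} {ν = ν} j≤n (p₁ , src₁ , edges₁ , acc₁) (p₂ , _ , edges₂ , acc₂)
         meet agree₁ agree₂ = p , src₁ , edges , acc
    where
    p : ∀ i → i ≤ n → Fin (size i)
    p i i≤n with i ≤? j
    ... | yes _ = p₁ i i≤n
    ... | no  _ = p₂ i i≤n

    meet′ : ∀ {i} (i≤n : i ≤ n) → i ≡ j → p₁ i i≤n ≡ p₂ i i≤n
    meet′ i≤n refl rewrite ≤-irrelevant i≤n j≤n = meet

    edges : ∀ i (i<n : i < n) →
            edge i i<n (p i (<⇒≤ i<n)) (ν (readAt order i<n)) (p (suc i) i<n) ≡ true
    edges i i<n with i ≤? j | suc i ≤? j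
    ... | yes _   | yes i<j  rewrite agree₁ i i<n i<j = edges₁ i i<n
    ... | no i≰j  | yes i<j  = contradiction (<⇒≤ i<j) i≰j
    ... | no i≰j  | no _     rewrite agree₂ i i<n (≰⇒≥ i≰j) = edges₂ i i<n
    ... | yes i≤j | no i≮j   rewrite agree₂ i i<n (≮⇒≥ i≮j)
                                | meet′ (<⇒≤ i<n) (≤-antisym i≤j (≮⇒≥ i≮j)) = edges₂ i i<n

    acc : accepting (p n ≤-refl) ≡ true
    acc with n ≤? j
    ... | yes _ = acc₁
    ... | no  _ = acc₂

module _ {q} (B : NOBDD n) (computes : NComputes B (EQS (q * 4) n)) (4q≤n : q * 4 ≤ n) where
  open NOBDD B

  private
    pairs : ℕ
    pairs = q + q

    pairs*2≡4q : pairs * 2 ≡ q * 4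
    pairs*2≡4q = trans (*-distribʳ-+ 2 q q) (sym (*-distribˡ-+ q 2 2))

    readBefore : ∀ j → Decidable (λ y → rank order y < j)
    readBefore j y = rank order y <? j

    valuesReadBefore : ℕ → ℕ
    valuesReadBefore j = αLength (readBefore j) pairs

    valuesReadBefore-step : ∀ j → j < n → valuesReadBefore (suc j) ≤ suc (valuesReadBefore j)
    valuesReadBefore-step j j<n = αLength-insert (readBefore (suc j)) (readBefore j)
      (Sum.map₂ (sym ∘ rank≡⇒ order j<n) ∘ m<1+n⇒m<n∨m≡n) pairs

    balanced-cut : ∃[ j ] j ≤ n × valuesReadBefore j ≡ q
    balanced-cut = intermediate-value valuesReadBefore n valuesReadBefore-step
      (≤-trans (≤-reflexive (αLength-empty (readBefore 0) (λ _ → n≮0) pairs)) z≤n)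
      (subst (q ≤_) (sym (αLength-full (readBefore n) pairs all-read)) (m≤m+n q q))
      where
      all-read : ∀ y → y < pairs * 2 → rank order y < n
      all-read y y<2pairs = rank<n order (<-≤-trans y<2pairs (subst (_≤ n) (sym pairs*2≡4q) 4q≤n))

    module Cut {j} (j≤n : j ≤ n) (balanced : valuesReadBefore j ≡ q) where

      cutInput : List Bool → List Bool → Fin n → Bool
      cutInput a b = input (interleave (readBefore j) pairs a b)

      βbalanced : βLength (readBefore j) pairs ≡ q
      βbalanced = +-cancelˡ-≡ q _ _
        (trans (cong (_+ βLength (readBefore j) pairs) (sym balanced))
               (αLength+βLength (readBefore j) pairs))

      EQS-cutInput : ∀ {a b} → length a ≡ q → length b ≡ q →
                     EQS (q * 4) n (cutInput a b) ≡ true ⇔ a ≡ b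
      EQS-cutInput {a} {b} |a| |b| = EQS-input (interleave (readBefore j) pairs a b)
        (trans (length-interleave (readBefore j) pairs a b) pairs*2≡4q) 4q≤n
        (splitAB-interleave (readBefore j) pairs (trans |a| (sym balanced)) (trans |b| (sym βbalanced)))

      acceptingPath : ∀ i → AcceptingPath (cutInput (word q i) (word q i))
      acceptingPath i = proj₁ (computes _)
        (Equivalence.from (EQS-cutInput (length-word q i) (length-word q i)) refl)

      node : Fin (2 ^ q) → Fin (size j)
      node i = proj₁ (acceptingPath i) j j≤n

      node-injective : ∀ {i i′} → node i ≡ node i′ → i ≡ i′
      node-injective {i} {i′} meet =
        word-injective q (Equivalence.to (EQS-cutInput (length-word q i) (length-word q i′))
                                         (proj₂ (computes _) spliced))
        where
        x x′ : List Bool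
        x  = word q i
        x′ = word q i′

        spliced : AcceptingPath (cutInput x x′)
        spliced = splice B {ν₁ = cutInput x x} {cutInput x′ x′} {cutInput x x′} j≤n
          (acceptingPath i) (acceptingPath i′) meet before after
          where
          before : ∀ s (s<n : s < n) → s < j →
                   cutInput x x′ (readAt order s<n) ≡ cutInput x x (readAt order s<n)
          before s s<n s<j = interleave-ignores-β (readBefore j) pairs
            (subst (_< j) (sym (rank-read order s<n)) s<j)
          after : ∀ s (s<n : s < n) → j ≤ s →
                  cutInput x x′ (readAt order s<n) ≡ cutInput x′ x′ (readAt order s<n)
          after s s<n j≤s = interleave-ignores-α (readBefore j) pairs
            (λ r<j → <⇒≱ (subst (_< j) (rank-read order s<n) r<j) j≤s)

  NOBDD-width-bound : 2 ^ q ≤ width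
  NOBDD-width-bound =
    let j , j≤n , balanced = balanced-cut
    in  ≤-trans (injective⇒≤ (Cut.node-injective j≤n balanced)) (≤-widthOf size j≤n)

lemma7 : ∀ (k : ℕ) → 4 ∣ k → 4 ≤ k →
         ∀ (m : ℕ) → ∃[ n ] (m ≤ n × k ≤ n × k ≤ 2 ^ (n / 4) ×
           (∀ (B : DOBDD n) → DComputes B (EQS k n) → 2 ^ (k / 4) ≤ DOBDD.width B) ×
           (∀ (B : NOBDD n) → NComputes B (EQS k n) → 2 ^ (k / 4) ≤ NOBDD.width B))
lemma7 k (divides q refl) _ m = N , m≤N , k≤N , k≤2^[N/4] , deterministic , nondeterministic
  where
  N : ℕ
  N = (k + m) * 4

  k+m≤N : k + m ≤ N
  k+m≤N = m≤m*n (k + m) 4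

  m≤N : m ≤ N
  m≤N = ≤-trans (m≤n+m m k) k+m≤N

  k≤N : k ≤ N
  k≤N = ≤-trans (m≤m+n k m) k+m≤N

  k≤2^[N/4] : k ≤ 2 ^ (N / 4)
  k≤2^[N/4] = subst (λ e → k ≤ 2 ^ e) (sym (m*n/n≡m (k + m) 4))
    (≤-trans (<⇒≤ (n<2^n k)) (^-monoʳ-≤ 2 (m≤m+n k m)))

  nondeterministic : ∀ (B : NOBDD N) → NComputes B (EQS k N) → 2 ^ (k / 4) ≤ NOBDD.width B
  nondeterministic B computes =
    subst (λ e → 2 ^ e ≤ NOBDD.width B) (sym (m*n/n≡m q 4))
          (NOBDD-width-bound {q = q} B computes k≤N)

  deterministic : ∀ (B : DOBDD N) → DComputes B (EQS k N) → 2 ^ (k / 4) ≤ DOBDD.width B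
  deterministic D computes = nondeterministic (toNOBDD D) (toNOBDD-computes D computes)
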